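{- Let $\mathcal{C}$ be a cartesian closed category which is non-degenerate, i.e. there exist objects $c', c$ of $\mathcal{C}$ and two distinct morphisms $f \neq g : c' \to c$. Then every language of $\lambda$-terms which is syntactically (Hillebrand–Kanellakis) recognizable is $\mathcal{C}$-recognizable: for every simple type $A$ and every $L \subseteq \mathrm{Tm}(A)$ such that there exist a simple type $B$ and a closed term $r \in \mathrm{Tm}(A[B] \to \mathrm{Bool})$ with $L = \{t \in \mathrm{Tm}(A) \mid r\ t[B] =_{\beta\eta} \mathsf{true}\}$, there exist an object $e$ of $\mathcal{C}$ and a subset $F \subseteq \mathcal{C}(1, [\![A]\!]_e)$ such that $L = \{t \in \mathrm{Tm}(A) \mid [\![t]\!]_e \in F\}$.
   Context: Simple types are generated by $A,B ::= o \mid A \to B \mid A \times B \mid 1$; terms are those of the simply typed $\lambda$-calculus with products and unit, with type-annotated abstractions $\lambda(x:A).t$, pairing $\langle t,u\rangle$ and projections $t_i$. $\mathrm{Tm}(A)$ denotes the set of closed terms of type $A$ modulo $\beta\eta$-conversion. CCCs come with specified terminal object, products and exponentials. For a CCC $\mathcal{C}$ and object $c$, $[\![A]\!]_c$ is defined by $[\![o]\!]_c = c$, $[\![A\to B]\!]_c = [\![A]\!]_c \Rightarrow [\![B]\!]_c$, $[\![A\times B]\!]_c = [\![A]\!]_c\times[\![B]\!]_c$, $[\![1]\!]_c = 1$, and $[\![t]\!]_c \in \mathcal{C}(1,[\![A]\!]_c)$ is the standard interpretation of $t\in\mathrm{Tm}(A)$ (equivalently, the unique strict CCC functor from the free CCC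 on one object, whose objects are simple types and whose morphisms $A\to B$ are $\mathrm{Tm}(A\to B)$, sending $o$ to $c$). For simple types $A,B$, $A[B]$ is $A$ with every occurrence of $o$ replaced by $B$, and $t[B]$ is $t$ with every type annotation $A'$ replaced by $A'[B]$; then $t\in\mathrm{Tm}(A)$ implies $t[B]\in\mathrm{Tm}(A[B])$. $\mathrm{Bool} := o\times o \to o$ and $\mathsf{true} := \lambda(x : o\times o).\,x_1$. -}

module Defs where

open import Level using (Level; _⊔_; suc)
open import Data.List using (List; []; _∷_; map)
open import Data.Product using (Σ; _,_)
open import Relation.Nullary using (¬_)
open import Relation.Binary.Structures using (IsEquivalence)

infixr 7 _⇒_
infixr 8 _⊗_

data Ty : Set where
  o   : Ty
  _⇒_ : Ty → Ty → Ty
  _⊗_ : Ty → Ty → Ty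
  𝟙   : Ty

Ctx : Set
Ctx = List Ty

-- Intrinsically typed terms (de Bruijn indices; the type annotation of
-- an abstraction λ(x:A).t is the index A of `lam`).

infix 4 _∋_

data _∋_ : Ctx → Ty → Set where
  here  : ∀ {Γ A} → (A ∷ Γ) ∋ A
  there : ∀ {Γ A B} → Γ ∋ A → (B ∷ Γ) ∋ A

data Tm (Γ : Ctx) : Ty → Set where
  var  : ∀ {A} → Γ ∋ A → Tm Γ A
  lam  : ∀ {A B} → Tm (A ∷ Γ) B → Tm Γ (A ⇒ B)
  app  : ∀ {A B} → Tm Γ (A ⇒ B) → Tm Γ A → Tm Γ B
  pair : ∀ {A B} → Tm Γ A → Tm Γ B → Tm Γ (A ⊗ B)
  fst  : ∀ {A B} → Tm Γ (A ⊗ B) → Tm Γ A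
  snd  : ∀ {A B} → Tm Γ (A ⊗ B) → Tm Γ B
  unit : Tm Γ 𝟙

CTm : Ty → Set
CTm A = Tm [] A

Ren : Ctx → Ctx → Set
Ren Γ Δ = ∀ {A} → Γ ∋ A → Δ ∋ A

ext : ∀ {Γ Δ B} → Ren Γ Δ → Ren (B ∷ Γ) (B ∷ Δ)
ext ρ here      = here
ext ρ (there x) = there (ρ x)

rename : ∀ {Γ Δ A} → Ren Γ Δ → Tm Γ A → Tm Δ A
rename ρ (var x)    = var (ρ x)
rename ρ (lam t)    = lam (rename (ext ρ) t)
rename ρ (app t u)  = app (rename ρ t) (rename ρ u)
rename ρ (pair t u) = pair (rename ρ t) (rename ρ u)
rename ρ (fst t)    = fst (rename ρ t)
rename ρ (snd t)    = snd (rename ρ t)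
rename ρ unit       = unit

weaken : ∀ {Γ A B} → Tm Γ A → Tm (B ∷ Γ) A
weaken = rename there

Sub : Ctx → Ctx → Set
Sub Γ Δ = ∀ {A} → Γ ∋ A → Tm Δ A

exts : ∀ {Γ Δ B} → Sub Γ Δ → Sub (B ∷ Γ) (B ∷ Δ)
exts σ here      = var here
exts σ (there x) = weaken (σ x)

subst : ∀ {Γ Δ A} → Sub Γ Δ → Tm Γ A → Tm Δ A
subst σ (var x)    = σ x
subst σ (lam t)    = lam (subst (exts σ) t)
subst σ (app t u)  = app (subst σ t) (subst σ u)
subst σ (pair t u) = pair (subst σ t) (subst σ u)
subst σ (fst t)    = fst (subst σ t)
subst σ (snd t)    = snd (subst σ t)
subst σ unit       = unit

_[_]₀ : ∀ {Γ A B} → Tm (B ∷ Γ) A → Tm Γ B → Tm Γ A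
_[_]₀ {Γ} {A} {B} t u = subst σ t
  where
  σ : Sub (B ∷ Γ) Γ
  σ here      = u
  σ (there x) = var x

infix 4 _≈βη_

data _≈βη_ {Γ : Ctx} : ∀ {A} → Tm Γ A → Tm Γ A → Set where
  ≈refl  : ∀ {A} {t : Tm Γ A} → t ≈βη t
  ≈sym   : ∀ {A} {t u : Tm Γ A} → t ≈βη u → u ≈βη t
  ≈trans : ∀ {A} {t u v : Tm Γ A} → t ≈βη u → u ≈βη v → t ≈βη v
  lam-cong  : ∀ {A B} {t t' : Tm (A ∷ Γ) B} → t ≈βη t' → lam t ≈βη lam t'
  app-cong  : ∀ {A B} {t t' : Tm Γ (A ⇒ B)} {u u' : Tm Γ A} →
              t ≈βη t' → u ≈βη u' → app t u ≈βη app t' u'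
  pair-cong : ∀ {A B} {t t' : Tm Γ A} {u u' : Tm Γ B} →
              t ≈βη t' → u ≈βη u' → pair t u ≈βη pair t' u'
  fst-cong  : ∀ {A B} {t t' : Tm Γ (A ⊗ B)} → t ≈βη t' → fst t ≈βη fst t'
  snd-cong  : ∀ {A B} {t t' : Tm Γ (A ⊗ B)} → t ≈βη t' → snd t ≈βη snd t'
  β⇒  : ∀ {A B} (t : Tm (A ∷ Γ) B) (u : Tm Γ A) → app (lam t) u ≈βη t [ u ]₀
  β⊗₁ : ∀ {A B} (t : Tm Γ A) (u : Tm Γ B) → fst (pair t u) ≈βη t
  β⊗₂ : ∀ {A B} (t : Tm Γ A) (u : Tm Γ B) → snd (pair t u) ≈βη u
  η⇒  : ∀ {A B} (t : Tm Γ (A ⇒ B)) → t ≈βη lam (app (weaken t) (var here))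
  η⊗  : ∀ {A B} (t : Tm Γ (A ⊗ B)) → t ≈βη pair (fst t) (snd t)
  η𝟙  : (t : Tm Γ 𝟙) → t ≈βη unit

_[_]ᵀ : Ty → Ty → Ty
o       [ B ]ᵀ = B
(A ⇒ C) [ B ]ᵀ = (A [ B ]ᵀ) ⇒ (C [ B ]ᵀ)
(A ⊗ C) [ B ]ᵀ = (A [ B ]ᵀ) ⊗ (C [ B ]ᵀ)
𝟙       [ B ]ᵀ = 𝟙

_[_]ᶜ : Ctx → Ty → Ctx
Γ [ B ]ᶜ = map (_[ B ]ᵀ) Γ

_[_]ᵛ : ∀ {Γ A} → Γ ∋ A → (B : Ty) → (Γ [ B ]ᶜ) ∋ (A [ B ]ᵀ)
here    [ B ]ᵛ = here
there x [ B ]ᵛ = there (x [ B ]ᵛ)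

_[_]ᵗ : ∀ {Γ A} → Tm Γ A → (B : Ty) → Tm (Γ [ B ]ᶜ) (A [ B ]ᵀ)
var x    [ B ]ᵗ = var (x [ B ]ᵛ)
lam t    [ B ]ᵗ = lam (t [ B ]ᵗ)
app t u  [ B ]ᵗ = app (t [ B ]ᵗ) (u [ B ]ᵗ)
pair t u [ B ]ᵗ = pair (t [ B ]ᵗ) (u [ B ]ᵗ)
fst t    [ B ]ᵗ = fst (t [ B ]ᵗ)
snd t    [ B ]ᵗ = snd (t [ B ]ᵗ)
unit     [ B ]ᵗ = unit

Bool : Ty
Bool = (o ⊗ o) ⇒ o

true : CTm Bool
true = lam (fst (var here))

record CCC (ℓo ℓ e : Level) : Set (suc (ℓo ⊔ ℓ ⊔ e)) where
  infix  4 _≈_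
  infixr 9 _∘_
  infixr 5 _⇛_
  infixr 6 _×_
  field
    Obj  : Set ℓo
    Hom  : Obj → Obj → Set ℓ
    _≈_  : ∀ {a b} → Hom a b → Hom a b → Set e
    ≈-equiv : ∀ {a b} → IsEquivalence (_≈_ {a} {b})
    id   : ∀ {a} → Hom a a
    _∘_  : ∀ {a b c} → Hom b c → Hom a b → Hom a c
    ∘-resp-≈ : ∀ {a b c} {f f' : Hom b c} {g g' : Hom a b} →
               f ≈ f' → g ≈ g' → f ∘ g ≈ f' ∘ g'
    assoc : ∀ {a b c d} {f : Hom c d} {g : Hom b c} {h : Hom a b} →
            (f ∘ g) ∘ h ≈ f ∘ (g ∘ h)
    identityˡ : ∀ {a b} {f : Hom a b} → id ∘ f ≈ f
    identityʳ : ∀ {a b} {f : Hom a b} → f ∘ id ≈ f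

    ⊤    : Obj
    !    : ∀ {a} → Hom a ⊤
    !-unique : ∀ {a} (f : Hom a ⊤) → ! ≈ f

    _×_  : Obj → Obj → Obj
    π₁   : ∀ {a b} → Hom (a × b) a
    π₂   : ∀ {a b} → Hom (a × b) b
    ⟨_,_⟩ : ∀ {c a b} → Hom c a → Hom c b → Hom c (a × b)
    project₁ : ∀ {c a b} {f : Hom c a} {g : Hom c b} → π₁ ∘ ⟨ f , g ⟩ ≈ f
    project₂ : ∀ {c a b} {f : Hom c a} {g : Hom c b} → π₂ ∘ ⟨ f , g ⟩ ≈ g
    ×-unique : ∀ {c a b} {h : Hom c (a × b)} {f : Hom c a} {g : Hom c b} →
               π₁ ∘ h ≈ f → π₂ ∘ h ≈ g → ⟨ f , g ⟩ ≈ h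

  _⁂_ : ∀ {a b c d} → Hom a b → Hom c d → Hom (a × c) (b × d)
  f ⁂ g = ⟨ f ∘ π₁ , g ∘ π₂ ⟩

  field
    _⇛_  : Obj → Obj → Obj
    eval : ∀ {a b} → Hom ((a ⇛ b) × a) b
    curry : ∀ {c a b} → Hom (c × a) b → Hom c (a ⇛ b)
    β-eval : ∀ {c a b} {f : Hom (c × a) b} → eval ∘ (curry f ⁂ id) ≈ f
    λ-unique : ∀ {c a b} {f : Hom (c × a) b} {h : Hom c (a ⇛ b)} →
               eval ∘ (h ⁂ id) ≈ f → h ≈ curry f

NonDegenerate : ∀ {ℓo ℓ e} → CCC ℓo ℓ e → Set (ℓo ⊔ ℓ ⊔ e)
NonDegenerate 𝒞 =
  Σ Obj λ c' → Σ Obj λ c → Σ (Hom c' c) λ f → Σ (Hom c' c) λ g → ¬ (f ≈ g)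
  where open CCC 𝒞

module Interp {ℓo ℓ e} (𝒞 : CCC ℓo ℓ e) where
  open CCC 𝒞

  ⟦_⟧ᵀ : Ty → Obj → Obj
  ⟦ o       ⟧ᵀ c = c
  ⟦ (A ⇒ B) ⟧ᵀ c = ⟦ A ⟧ᵀ c ⇛ ⟦ B ⟧ᵀ c
  ⟦ (A ⊗ B) ⟧ᵀ c = ⟦ A ⟧ᵀ c × ⟦ B ⟧ᵀ c
  ⟦ 𝟙       ⟧ᵀ c = ⊤

  ⟦_⟧ᶜ : Ctx → Obj → Obj
  ⟦ []    ⟧ᶜ c = ⊤
  ⟦ A ∷ Γ ⟧ᶜ c = ⟦ Γ ⟧ᶜ c × ⟦ A ⟧ᵀ c

  ⟦_⟧ᵛ : ∀ {Γ A} → Γ ∋ A → (c : Obj) → Hom (⟦ Γ ⟧ᶜ c) (⟦ A ⟧ᵀ c)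
  ⟦ here    ⟧ᵛ c = π₂
  ⟦ there x ⟧ᵛ c = ⟦ x ⟧ᵛ c ∘ π₁

  ⟦_⟧ᵗ : ∀ {Γ A} → Tm Γ A → (c : Obj) → Hom (⟦ Γ ⟧ᶜ c) (⟦ A ⟧ᵀ c)
  ⟦ var x    ⟧ᵗ c = ⟦ x ⟧ᵛ c
  ⟦ lam t    ⟧ᵗ c = curry (⟦ t ⟧ᵗ c)
  ⟦ app t u  ⟧ᵗ c = eval ∘ ⟨ ⟦ t ⟧ᵗ c , ⟦ u ⟧ᵗ c ⟩
  ⟦ pair t u ⟧ᵗ c = ⟨ ⟦ t ⟧ᵗ c , ⟦ u ⟧ᵗ c ⟩
  ⟦ fst t    ⟧ᵗ c = π₁ ∘ ⟦ t ⟧ᵗ c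
  ⟦ snd t    ⟧ᵗ c = π₂ ∘ ⟦ t ⟧ᵗ c
  ⟦ unit     ⟧ᵗ c = !

module Submission where

open import Defs
open import Data.Empty using (⊥-elim)
open import Data.List using ([]; _∷_)
open import Data.Product using (Σ; _×_; _,_; proj₁; proj₂)
open import Data.Sum using (_⊎_; inj₁; inj₂)
open import Data.Unit.Polymorphic using () renaming (⊤ to Unit)
open import Function.Bundles using (_⇔_; mk⇔)
open import Function.Construct.Composition using (_⇔-∘_)
open import Level using (Lift; lift; _⊔_)
open import Relation.Binary.Bundles using (Setoid)
open import Relation.Binary.PropositionalEquality
  using (_≡_; refl; cong; cong₂; subst₂)
  renaming (subst to ≡-subst; trans to ≡-trans; sym to ≡-sym)
open import Relation.Binary.Structures using (IsEquivalence)
open import Relation.Nullary using (¬_)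
import Relation.Binary.Reasoning.Setoid as SetoidReasoning

-- Take e := ⟦ B ⟧ c.  Since ⟦ A [ B ] ⟧ c = ⟦ A ⟧ e, the recogniser r can
-- be run semantically on ⟦ t ⟧ e, and a global boolean is observed by
-- applying it to the pair ⟨ f , g ⟩ of the two distinct morphisms.  A
-- logical relation between terms in the context x : o × o and morphisms
-- out of c' shows that every closed u : Bool satisfies u x =βη x₁ with
-- observation f, or u x =βη x₂ with observation g; as f ≉ g, the
-- observation f characterises u =βη true.

_≗ʳ_ : ∀ {Γ Δ} → Ren Γ Δ → Ren Γ Δ → Set
_≗ʳ_ {Γ} ρ ρ' = ∀ {A} (x : Γ ∋ A) → ρ x ≡ ρ' x

_≗ˢ_ : ∀ {Γ Δ} → Sub Γ Δ → Sub Γ Δ → Set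
_≗ˢ_ {Γ} σ σ' = ∀ {A} (x : Γ ∋ A) → σ x ≡ σ' x

ext-cong : ∀ {Γ Δ B} {ρ ρ' : Ren Γ Δ} → ρ ≗ʳ ρ' → ext {B = B} ρ ≗ʳ ext ρ'
ext-cong p here      = refl
ext-cong p (there x) = cong there (p x)

rename-cong : ∀ {Γ Δ A} {ρ ρ' : Ren Γ Δ} → ρ ≗ʳ ρ' → (t : Tm Γ A) → rename ρ t ≡ rename ρ' t
rename-cong p (var x)    = cong var (p x)
rename-cong p (lam t)    = cong lam (rename-cong (ext-cong p) t)
rename-cong p (app t u)  = cong₂ app (rename-cong p t) (rename-cong p u)
rename-cong p (pair t u) = cong₂ pair (rename-cong p t) (rename-cong p u)
rename-cong p (fst t)    = cong fst (rename-cong p t)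
rename-cong p (snd t)    = cong snd (rename-cong p t)
rename-cong p unit       = refl

exts-cong : ∀ {Γ Δ B} {σ σ' : Sub Γ Δ} → σ ≗ˢ σ' → exts {B = B} σ ≗ˢ exts σ'
exts-cong p here      = refl
exts-cong p (there x) = cong weaken (p x)

subst-cong : ∀ {Γ Δ A} {σ σ' : Sub Γ Δ} → σ ≗ˢ σ' → (t : Tm Γ A) → subst σ t ≡ subst σ' t
subst-cong p (var x)    = p x
subst-cong p (lam t)    = cong lam (subst-cong (exts-cong p) t)
subst-cong p (app t u)  = cong₂ app (subst-cong p t) (subst-cong p u)
subst-cong p (pair t u) = cong₂ pair (subst-cong p t) (subst-cong p u)
subst-cong p (fst t)    = cong fst (subst-cong p t)
subst-cong p (snd t)    = cong snd (subst-cong p t)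
subst-cong p unit       = refl

rename-rename : ∀ {Γ Δ Θ A} (ρ : Ren Δ Θ) (ρ' : Ren Γ Δ) (t : Tm Γ A) →
                rename ρ (rename ρ' t) ≡ rename (λ x → ρ (ρ' x)) t
rename-rename ρ ρ' (var x)    = refl
rename-rename ρ ρ' (lam t)    = cong lam (≡-trans (rename-rename (ext ρ) (ext ρ') t)
  (rename-cong (λ { here → refl ; (there x) → refl }) t))
rename-rename ρ ρ' (app t u)  = cong₂ app (rename-rename ρ ρ' t) (rename-rename ρ ρ' u)
rename-rename ρ ρ' (pair t u) = cong₂ pair (rename-rename ρ ρ' t) (rename-rename ρ ρ' u)
rename-rename ρ ρ' (fst t)    = cong fst (rename-rename ρ ρ' t)
rename-rename ρ ρ' (snd t)    = cong snd (rename-rename ρ ρ' t)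
rename-rename ρ ρ' unit       = refl

rename-subst : ∀ {Γ Δ Θ A} (ρ : Ren Δ Θ) (σ : Sub Γ Δ) (t : Tm Γ A) →
               rename ρ (subst σ t) ≡ subst (λ x → rename ρ (σ x)) t
rename-subst ρ σ (var x)    = refl
rename-subst ρ σ (lam t)    = cong lam (≡-trans (rename-subst (ext ρ) (exts σ) t)
  (subst-cong (λ { here → refl
                 ; (there x) → ≡-trans (rename-rename (ext ρ) there (σ x))
                                       (≡-sym (rename-rename there ρ (σ x))) }) t))
rename-subst ρ σ (app t u)  = cong₂ app (rename-subst ρ σ t) (rename-subst ρ σ u)
rename-subst ρ σ (pair t u) = cong₂ pair (rename-subst ρ σ t) (rename-subst ρ σ u)
rename-subst ρ σ (fst t)    = cong fst (rename-subst ρ σ t)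
rename-subst ρ σ (snd t)    = cong snd (rename-subst ρ σ t)
rename-subst ρ σ unit       = refl

subst-rename : ∀ {Γ Δ Θ A} (σ : Sub Δ Θ) (ρ : Ren Γ Δ) (t : Tm Γ A) →
               subst σ (rename ρ t) ≡ subst (λ x → σ (ρ x)) t
subst-rename σ ρ (var x)    = refl
subst-rename σ ρ (lam t)    = cong lam (≡-trans (subst-rename (exts σ) (ext ρ) t)
  (subst-cong (λ { here → refl ; (there x) → refl }) t))
subst-rename σ ρ (app t u)  = cong₂ app (subst-rename σ ρ t) (subst-rename σ ρ u)
subst-rename σ ρ (pair t u) = cong₂ pair (subst-rename σ ρ t) (subst-rename σ ρ u)
subst-rename σ ρ (fst t)    = cong fst (subst-rename σ ρ t)
subst-rename σ ρ (snd t)    = cong snd (subst-rename σ ρ t)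
subst-rename σ ρ unit       = refl

subst-subst : ∀ {Γ Δ Θ A} (τ : Sub Δ Θ) (σ : Sub Γ Δ) (t : Tm Γ A) →
              subst τ (subst σ t) ≡ subst (λ x → subst τ (σ x)) t
subst-subst τ σ (var x)    = refl
subst-subst τ σ (lam t)    = cong lam (≡-trans (subst-subst (exts τ) (exts σ) t)
  (subst-cong (λ { here → refl
                 ; (there x) → ≡-trans (subst-rename (exts τ) there (σ x))
                                       (≡-sym (rename-subst there τ (σ x))) }) t))
subst-subst τ σ (app t u)  = cong₂ app (subst-subst τ σ t) (subst-subst τ σ u)
subst-subst τ σ (pair t u) = cong₂ pair (subst-subst τ σ t) (subst-subst τ σ u)
subst-subst τ σ (fst t)    = cong fst (subst-subst τ σ t)
subst-subst τ σ (snd t)    = cong snd (subst-subst τ σ t)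
subst-subst τ σ unit       = refl

subst-var : ∀ {Γ A} (t : Tm Γ A) → subst var t ≡ t
subst-var (var x)    = refl
subst-var (lam t)    = cong lam (≡-trans (subst-cong (λ { here → refl ; (there x) → refl }) t)
                                         (subst-var t))
subst-var (app t u)  = cong₂ app (subst-var t) (subst-var u)
subst-var (pair t u) = cong₂ pair (subst-var t) (subst-var u)
subst-var (fst t)    = cong fst (subst-var t)
subst-var (snd t)    = cong snd (subst-var t)
subst-var unit       = refl

rename≡subst-var : ∀ {Γ Δ A} (ρ : Ren Γ Δ) (t : Tm Γ A) → rename ρ t ≡ subst (λ x → var (ρ x)) t
rename≡subst-var ρ (var x)    = refl
rename≡subst-var ρ (lam t)    = cong lam (≡-trans (rename≡subst-var (ext ρ) t)
  (subst-cong (λ { here → refl ; (there x) → refl }) t))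
rename≡subst-var ρ (app t u)  = cong₂ app (rename≡subst-var ρ t) (rename≡subst-var ρ u)
rename≡subst-var ρ (pair t u) = cong₂ pair (rename≡subst-var ρ t) (rename≡subst-var ρ u)
rename≡subst-var ρ (fst t)    = cong fst (rename≡subst-var ρ t)
rename≡subst-var ρ (snd t)    = cong snd (rename≡subst-var ρ t)
rename≡subst-var ρ unit       = refl

infixr 5 _∷ˢ_

_∷ˢ_ : ∀ {Γ Δ A} → Tm Δ A → Sub Γ Δ → Sub (A ∷ Γ) Δ
(s ∷ˢ σ) here      = s
(s ∷ˢ σ) (there x) = σ x

subst-exts-[]₀ : ∀ {Γ Δ A B} (σ : Sub Γ Δ) (t : Tm (A ∷ Γ) B) (s : Tm Δ A) →
                 subst (exts σ) t [ s ]₀ ≡ subst (s ∷ˢ σ) t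
subst-exts-[]₀ σ t s = ≡-trans (subst-subst _ (exts σ) t)
  (subst-cong (λ { here → refl
                 ; (there x) → ≡-trans (subst-rename _ there (σ x)) (subst-var (σ x)) }) t)

module CCCProperties {ℓo ℓh ℓe} (𝒞 : CCC ℓo ℓh ℓe) where
  open CCC 𝒞 renaming (_×_ to _⊠_)
  module ≈ {a b} = IsEquivalence (≈-equiv {a} {b})

  homSetoid : Obj → Obj → Setoid ℓh ℓe
  homSetoid a b = record { Carrier = Hom a b ; _≈_ = _≈_ ; isEquivalence = ≈-equiv }

  module HomReasoning {a b : Obj} = SetoidReasoning (homSetoid a b)
  open HomReasoning using (begin_; step-≈-⟩; step-≈-⟨; _∎)

  ∘-resp-≈ˡ : ∀ {a b c} {f f' : Hom b c} {g : Hom a b} → f ≈ f' → f ∘ g ≈ f' ∘ g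
  ∘-resp-≈ˡ p = ∘-resp-≈ p ≈.refl

  ∘-resp-≈ʳ : ∀ {a b c} {f : Hom b c} {g g' : Hom a b} → g ≈ g' → f ∘ g ≈ f ∘ g'
  ∘-resp-≈ʳ p = ∘-resp-≈ ≈.refl p

  !-∘ : ∀ {a b} (h : Hom a b) → ! ≈ ! ∘ h
  !-∘ h = !-unique (! ∘ h)

  ⟨⟩-cong : ∀ {c a b} {f f' : Hom c a} {g g' : Hom c b} → f ≈ f' → g ≈ g' → ⟨ f , g ⟩ ≈ ⟨ f' , g' ⟩
  ⟨⟩-cong p q = ×-unique (≈.trans project₁ (≈.sym p)) (≈.trans project₂ (≈.sym q))

  ⟨⟩∘ : ∀ {d c a b} {f : Hom c a} {g : Hom c b} {h : Hom d c} → ⟨ f , g ⟩ ∘ h ≈ ⟨ f ∘ h , g ∘ h ⟩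
  ⟨⟩∘ = ≈.sym (×-unique (≈.trans (≈.sym assoc) (∘-resp-≈ˡ project₁))
                        (≈.trans (≈.sym assoc) (∘-resp-≈ˡ project₂)))

  ⟨π₁,π₂⟩≈id : ∀ {a b} → ⟨ π₁ {a} {b} , π₂ ⟩ ≈ id
  ⟨π₁,π₂⟩≈id = ×-unique identityʳ identityʳ

  curry-cong : ∀ {c a b} {f f' : Hom (c ⊠ a) b} → f ≈ f' → curry f ≈ curry f'
  curry-cong p = λ-unique (≈.trans β-eval p)

  ⁂∘⟨⟩ : ∀ {x a b c d} {f : Hom a b} {g : Hom c d} {h : Hom x a} {k : Hom x c} →
         (f ⁂ g) ∘ ⟨ h , k ⟩ ≈ ⟨ f ∘ h , g ∘ k ⟩
  ⁂∘⟨⟩ = ≈.trans ⟨⟩∘ (⟨⟩-cong (≈.trans assoc (∘-resp-≈ʳ project₁))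
                              (≈.trans assoc (∘-resp-≈ʳ project₂)))

  eval∘⟨curry∘,⟩ : ∀ {x c a b} {f : Hom (c ⊠ a) b} {h : Hom x c} {k : Hom x a} →
                   eval ∘ ⟨ curry f ∘ h , k ⟩ ≈ f ∘ ⟨ h , k ⟩
  eval∘⟨curry∘,⟩ {f = f} {h} {k} = begin
    eval ∘ ⟨ curry f ∘ h , k ⟩             ≈⟨ ∘-resp-≈ʳ (⟨⟩-cong ≈.refl identityˡ) ⟨
    eval ∘ ⟨ curry f ∘ h , id ∘ k ⟩        ≈⟨ ∘-resp-≈ʳ ⁂∘⟨⟩ ⟨
    eval ∘ ((curry f ⁂ id) ∘ ⟨ h , k ⟩)    ≈⟨ assoc ⟨
    (eval ∘ (curry f ⁂ id)) ∘ ⟨ h , k ⟩    ≈⟨ ∘-resp-≈ˡ β-eval ⟩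
    f ∘ ⟨ h , k ⟩                          ∎

  curry∘ : ∀ {x c a b} {f : Hom (c ⊠ a) b} {h : Hom x c} → curry f ∘ h ≈ curry (f ∘ (h ⁂ id))
  curry∘ = λ-unique (≈.trans (∘-resp-≈ʳ (⟨⟩-cong assoc ≈.refl)) eval∘⟨curry∘,⟩)

module Soundness {ℓo ℓh ℓe} (𝒞 : CCC ℓo ℓh ℓe) (c : CCC.Obj 𝒞) where
  open CCC 𝒞 renaming (_×_ to _⊠_)
  open Interp 𝒞
  open CCCProperties 𝒞

  ⟦_⟧ˢ : ∀ {Γ Δ} → Sub Γ Δ → Hom (⟦ Δ ⟧ᶜ c) (⟦ Γ ⟧ᶜ c)
  ⟦_⟧ˢ {[]}    σ = !
  ⟦_⟧ˢ {A ∷ Γ} σ = ⟨ ⟦ (λ x → σ (there x)) ⟧ˢ , ⟦ σ here ⟧ᵗ c ⟩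

  ⟦var⟧∘⟦⟧ˢ : ∀ {Γ Δ A} (σ : Sub Γ Δ) (x : Γ ∋ A) → ⟦ x ⟧ᵛ c ∘ ⟦ σ ⟧ˢ ≈ ⟦ σ x ⟧ᵗ c
  ⟦var⟧∘⟦⟧ˢ σ here      = project₂
  ⟦var⟧∘⟦⟧ˢ σ (there x) =
    ≈.trans assoc (≈.trans (∘-resp-≈ʳ project₁) (⟦var⟧∘⟦⟧ˢ (λ y → σ (there y)) x))

  ⟦there∘⟧ˢ : ∀ {Γ Δ B} (ρ : Ren Γ Δ) →
              ⟦ (λ x → var (there {B = B} (ρ x))) ⟧ˢ ≈ ⟦ (λ x → var (ρ x)) ⟧ˢ ∘ π₁
  ⟦there∘⟧ˢ {[]}    ρ = !-∘ π₁
  ⟦there∘⟧ˢ {A ∷ Γ} ρ = ≈.trans (⟨⟩-cong (⟦there∘⟧ˢ (λ x → ρ (there x))) ≈.refl) (≈.sym ⟨⟩∘)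

  ⟦var⟧ˢ≈id : ∀ {Γ} → ⟦ (λ {A} (x : Γ ∋ A) → var x) ⟧ˢ ≈ id
  ⟦var∘there⟧ˢ≈π₁ : ∀ {Γ B} → ⟦ (λ {A} (x : Γ ∋ A) → var (there {B = B} x)) ⟧ˢ ≈ π₁

  ⟦var⟧ˢ≈id {[]}    = !-unique id
  ⟦var⟧ˢ≈id {A ∷ Γ} = ≈.trans (⟨⟩-cong (⟦var∘there⟧ˢ≈π₁ {Γ}) ≈.refl) ⟨π₁,π₂⟩≈id

  ⟦var∘there⟧ˢ≈π₁ {Γ} {B} =
    ≈.trans (⟦there∘⟧ˢ {Γ} {Γ} {B} (λ x → x)) (≈.trans (∘-resp-≈ˡ (⟦var⟧ˢ≈id {Γ})) identityˡ)

  ⟦rename⟧ : ∀ {Γ Δ A} (ρ : Ren Γ Δ) (t : Tm Γ A) →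
             ⟦ rename ρ t ⟧ᵗ c ≈ ⟦ t ⟧ᵗ c ∘ ⟦ (λ x → var (ρ x)) ⟧ˢ
  ⟦rename⟧ ρ (var x)    = ≈.sym (⟦var⟧∘⟦⟧ˢ (λ x → var (ρ x)) x)
  ⟦rename⟧ ρ (lam t)    = ≈.trans
    (curry-cong (≈.trans (⟦rename⟧ (ext ρ) t) (∘-resp-≈ʳ (⟨⟩-cong (⟦there∘⟧ˢ ρ) (≈.sym identityˡ)))))
    (≈.sym curry∘)
  ⟦rename⟧ ρ (app t u)  = ≈.trans
    (∘-resp-≈ʳ (≈.trans (⟨⟩-cong (⟦rename⟧ ρ t) (⟦rename⟧ ρ u)) (≈.sym ⟨⟩∘)))
    (≈.sym assoc)
  ⟦rename⟧ ρ (pair t u) = ≈.trans (⟨⟩-cong (⟦rename⟧ ρ t) (⟦rename⟧ ρ u)) (≈.sym ⟨⟩∘)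
  ⟦rename⟧ ρ (fst t)    = ≈.trans (∘-resp-≈ʳ (⟦rename⟧ ρ t)) (≈.sym assoc)
  ⟦rename⟧ ρ (snd t)    = ≈.trans (∘-resp-≈ʳ (⟦rename⟧ ρ t)) (≈.sym assoc)
  ⟦rename⟧ ρ unit       = !-∘ _

  ⟦weaken⟧ : ∀ {Γ A B} (t : Tm Γ A) → ⟦ weaken {B = B} t ⟧ᵗ c ≈ ⟦ t ⟧ᵗ c ∘ π₁
  ⟦weaken⟧ {Γ} {B = B} t = ≈.trans (⟦rename⟧ there t) (∘-resp-≈ʳ (⟦var∘there⟧ˢ≈π₁ {Γ} {B}))

  ⟦weaken∘⟧ˢ : ∀ {Γ Δ B} (σ : Sub Γ Δ) → ⟦ (λ x → weaken {B = B} (σ x)) ⟧ˢ ≈ ⟦ σ ⟧ˢ ∘ π₁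
  ⟦weaken∘⟧ˢ {[]}    σ = !-∘ π₁
  ⟦weaken∘⟧ˢ {A ∷ Γ} σ =
    ≈.trans (⟨⟩-cong (⟦weaken∘⟧ˢ (λ x → σ (there x))) (⟦weaken⟧ (σ here))) (≈.sym ⟨⟩∘)

  ⟦subst⟧ : ∀ {Γ Δ A} (σ : Sub Γ Δ) (t : Tm Γ A) → ⟦ subst σ t ⟧ᵗ c ≈ ⟦ t ⟧ᵗ c ∘ ⟦ σ ⟧ˢ
  ⟦subst⟧ σ (var x)    = ≈.sym (⟦var⟧∘⟦⟧ˢ σ x)
  ⟦subst⟧ σ (lam t)    = ≈.trans
    (curry-cong (≈.trans (⟦subst⟧ (exts σ) t) (∘-resp-≈ʳ (⟨⟩-cong (⟦weaken∘⟧ˢ σ) (≈.sym identityˡ)))))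
    (≈.sym curry∘)
  ⟦subst⟧ σ (app t u)  = ≈.trans
    (∘-resp-≈ʳ (≈.trans (⟨⟩-cong (⟦subst⟧ σ t) (⟦subst⟧ σ u)) (≈.sym ⟨⟩∘)))
    (≈.sym assoc)
  ⟦subst⟧ σ (pair t u) = ≈.trans (⟨⟩-cong (⟦subst⟧ σ t) (⟦subst⟧ σ u)) (≈.sym ⟨⟩∘)
  ⟦subst⟧ σ (fst t)    = ≈.trans (∘-resp-≈ʳ (⟦subst⟧ σ t)) (≈.sym assoc)
  ⟦subst⟧ σ (snd t)    = ≈.trans (∘-resp-≈ʳ (⟦subst⟧ σ t)) (≈.sym assoc)
  ⟦subst⟧ σ unit       = !-∘ _

  ⟦[]₀⟧ : ∀ {Γ A B} (t : Tm (B ∷ Γ) A) (u : Tm Γ B) → ⟦ t [ u ]₀ ⟧ᵗ c ≈ ⟦ t ⟧ᵗ c ∘ ⟨ id , ⟦ u ⟧ᵗ c ⟩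
  ⟦[]₀⟧ {Γ} t u = ≈.trans (⟦subst⟧ _ t) (∘-resp-≈ʳ (⟨⟩-cong (⟦var⟧ˢ≈id {Γ}) ≈.refl))

  sound : ∀ {Γ A} {t u : Tm Γ A} → t ≈βη u → ⟦ t ⟧ᵗ c ≈ ⟦ u ⟧ᵗ c
  sound ≈refl           = ≈.refl
  sound (≈sym p)        = ≈.sym (sound p)
  sound (≈trans p q)    = ≈.trans (sound p) (sound q)
  sound (lam-cong p)    = curry-cong (sound p)
  sound (app-cong p q)  = ∘-resp-≈ʳ (⟨⟩-cong (sound p) (sound q))
  sound (pair-cong p q) = ⟨⟩-cong (sound p) (sound q)
  sound (fst-cong p)    = ∘-resp-≈ʳ (sound p)
  sound (snd-cong p)    = ∘-resp-≈ʳ (sound p)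
  sound (β⇒ t u)        = ≈.trans (∘-resp-≈ʳ (⟨⟩-cong (≈.sym identityʳ) ≈.refl))
                                  (≈.trans eval∘⟨curry∘,⟩ (≈.sym (⟦[]₀⟧ t u)))
  sound (β⊗₁ t u)       = project₁
  sound (β⊗₂ t u)       = project₂
  sound (η⇒ t)          = λ-unique (∘-resp-≈ʳ (⟨⟩-cong (≈.sym (⟦weaken⟧ t)) identityˡ))
  sound (η⊗ t)          = ≈.sym (×-unique ≈.refl ≈.refl)
  sound (η𝟙 t)          = ≈.sym (!-unique _)

module TypeSubstitution {ℓo ℓh ℓe} (𝒞 : CCC ℓo ℓh ℓe) (c : CCC.Obj 𝒞) (B : Ty) where
  open CCC 𝒞 renaming (_×_ to _⊠_)
  open Interp 𝒞

  ⟦⟧ᵀ-[]ᵀ : ∀ A → ⟦ A ⟧ᵀ (⟦ B ⟧ᵀ c) ≡ ⟦ A [ B ]ᵀ ⟧ᵀ c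
  ⟦⟧ᵀ-[]ᵀ o       = refl
  ⟦⟧ᵀ-[]ᵀ (A ⇒ C) = cong₂ _⇛_ (⟦⟧ᵀ-[]ᵀ A) (⟦⟧ᵀ-[]ᵀ C)
  ⟦⟧ᵀ-[]ᵀ (A ⊗ C) = cong₂ _⊠_ (⟦⟧ᵀ-[]ᵀ A) (⟦⟧ᵀ-[]ᵀ C)
  ⟦⟧ᵀ-[]ᵀ 𝟙       = refl

  ⟦⟧ᶜ-[]ᶜ : ∀ Γ → ⟦ Γ ⟧ᶜ (⟦ B ⟧ᵀ c) ≡ ⟦ Γ [ B ]ᶜ ⟧ᶜ c
  ⟦⟧ᶜ-[]ᶜ []      = refl
  ⟦⟧ᶜ-[]ᶜ (A ∷ Γ) = cong₂ _⊠_ (⟦⟧ᶜ-[]ᶜ Γ) (⟦⟧ᵀ-[]ᵀ A)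

  cast : ∀ {X X' Y Y'} → X ≡ X' → Y ≡ Y' → Hom X Y → Hom X' Y'
  cast = subst₂ Hom

  cast-≈ : ∀ {X X' Y Y'} (p : X ≡ X') (q : Y ≡ Y') {h h' : Hom X Y} → h ≈ h' → cast p q h ≈ cast p q h'
  cast-≈ refl refl h≈h' = h≈h'

  cast-π₂ : ∀ {X X' Y Y'} (p : X ≡ X') (q : Y ≡ Y') → cast (cong₂ _⊠_ p q) q π₂ ≡ π₂
  cast-π₂ refl refl = refl

  cast-∘π₁ : ∀ {X X' Y Y' Z Z'} (p : X ≡ X') (q : Y ≡ Y') (r : Z ≡ Z') (h : Hom X Z) →
             cast (cong₂ _⊠_ p q) r (h ∘ π₁) ≡ cast p r h ∘ π₁
  cast-∘π₁ refl refl refl h = refl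

  cast-curry : ∀ {X X' Y Y' Z Z'} (p : X ≡ X') (q : Y ≡ Y') (r : Z ≡ Z') (h : Hom (X ⊠ Y) Z) →
               cast p (cong₂ _⇛_ q r) (curry h) ≡ curry (cast (cong₂ _⊠_ p q) r h)
  cast-curry refl refl refl h = refl

  cast-eval∘⟨⟩ : ∀ {X X' Y Y' Z Z'} (p : X ≡ X') (q : Y ≡ Y') (r : Z ≡ Z')
                 (h : Hom X (Y ⇛ Z)) (k : Hom X Y) →
                 cast p r (eval ∘ ⟨ h , k ⟩) ≡ eval ∘ ⟨ cast p (cong₂ _⇛_ q r) h , cast p q k ⟩
  cast-eval∘⟨⟩ refl refl refl h k = refl

  cast-⟨⟩ : ∀ {X X' Y Y' Z Z'} (p : X ≡ X') (q : Y ≡ Y') (r : Z ≡ Z') (h : Hom X Y) (k : Hom X Z) →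
            cast p (cong₂ _⊠_ q r) ⟨ h , k ⟩ ≡ ⟨ cast p q h , cast p r k ⟩
  cast-⟨⟩ refl refl refl h k = refl

  cast-π₁∘ : ∀ {X X' Y Y' Z Z'} (p : X ≡ X') (q : Y ≡ Y') (r : Z ≡ Z') (h : Hom X (Y ⊠ Z)) →
             cast p q (π₁ ∘ h) ≡ π₁ ∘ cast p (cong₂ _⊠_ q r) h
  cast-π₁∘ refl refl refl h = refl

  cast-π₂∘ : ∀ {X X' Y Y' Z Z'} (p : X ≡ X') (q : Y ≡ Y') (r : Z ≡ Z') (h : Hom X (Y ⊠ Z)) →
             cast p r (π₂ ∘ h) ≡ π₂ ∘ cast p (cong₂ _⊠_ q r) h
  cast-π₂∘ refl refl refl h = refl

  cast-! : ∀ {X X'} (p : X ≡ X') → cast p refl ! ≡ !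
  cast-! refl = refl

  ⟦⟧ᵛ-[]ᵛ : ∀ {Γ A} (x : Γ ∋ A) →
            cast (⟦⟧ᶜ-[]ᶜ Γ) (⟦⟧ᵀ-[]ᵀ A) (⟦ x ⟧ᵛ (⟦ B ⟧ᵀ c)) ≡ ⟦ x [ B ]ᵛ ⟧ᵛ c
  ⟦⟧ᵛ-[]ᵛ {A ∷ Γ}      here      = cast-π₂ (⟦⟧ᶜ-[]ᶜ Γ) (⟦⟧ᵀ-[]ᵀ A)
  ⟦⟧ᵛ-[]ᵛ {A' ∷ Γ} {A} (there x) =
    ≡-trans (cast-∘π₁ (⟦⟧ᶜ-[]ᶜ Γ) (⟦⟧ᵀ-[]ᵀ A') (⟦⟧ᵀ-[]ᵀ A) _) (cong (_∘ π₁) (⟦⟧ᵛ-[]ᵛ x))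

  ⟦⟧ᵗ-[]ᵗ : ∀ {Γ A} (t : Tm Γ A) →
            cast (⟦⟧ᶜ-[]ᶜ Γ) (⟦⟧ᵀ-[]ᵀ A) (⟦ t ⟧ᵗ (⟦ B ⟧ᵀ c)) ≡ ⟦ t [ B ]ᵗ ⟧ᵗ c
  ⟦⟧ᵗ-[]ᵗ (var x) = ⟦⟧ᵛ-[]ᵛ x
  ⟦⟧ᵗ-[]ᵗ {Γ} (lam {A} {C} t) =
    ≡-trans (cast-curry (⟦⟧ᶜ-[]ᶜ Γ) (⟦⟧ᵀ-[]ᵀ A) (⟦⟧ᵀ-[]ᵀ C) _) (cong curry (⟦⟧ᵗ-[]ᵗ t))
  ⟦⟧ᵗ-[]ᵗ {Γ} {C} (app {A} t u) =
    ≡-trans (cast-eval∘⟨⟩ (⟦⟧ᶜ-[]ᶜ Γ) (⟦⟧ᵀ-[]ᵀ A) (⟦⟧ᵀ-[]ᵀ C) _ _)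
            (cong₂ (λ h k → eval ∘ ⟨ h , k ⟩) (⟦⟧ᵗ-[]ᵗ t) (⟦⟧ᵗ-[]ᵗ u))
  ⟦⟧ᵗ-[]ᵗ {Γ} (pair {A} {C} t u) =
    ≡-trans (cast-⟨⟩ (⟦⟧ᶜ-[]ᶜ Γ) (⟦⟧ᵀ-[]ᵀ A) (⟦⟧ᵀ-[]ᵀ C) _ _) (cong₂ ⟨_,_⟩ (⟦⟧ᵗ-[]ᵗ t) (⟦⟧ᵗ-[]ᵗ u))
  ⟦⟧ᵗ-[]ᵗ {Γ} (fst {A} {C} t) =
    ≡-trans (cast-π₁∘ (⟦⟧ᶜ-[]ᶜ Γ) (⟦⟧ᵀ-[]ᵀ A) (⟦⟧ᵀ-[]ᵀ C) _) (cong (π₁ ∘_) (⟦⟧ᵗ-[]ᵗ t))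
  ⟦⟧ᵗ-[]ᵗ {Γ} (snd {A} {C} t) =
    ≡-trans (cast-π₂∘ (⟦⟧ᶜ-[]ᶜ Γ) (⟦⟧ᵀ-[]ᵀ A) (⟦⟧ᵀ-[]ᵀ C) _) (cong (π₂ ∘_) (⟦⟧ᵗ-[]ᵗ t))
  ⟦⟧ᵗ-[]ᵗ {Γ} unit = cast-! (⟦⟧ᶜ-[]ᶜ Γ)

module BoolObservation {ℓo ℓh ℓe} (𝒞 : CCC ℓo ℓh ℓe) {c' c : CCC.Obj 𝒞} (f g : CCC.Hom 𝒞 c' c) where
  open CCC 𝒞 renaming (_×_ to _⊠_)
  open Interp 𝒞
  open CCCProperties 𝒞
  open HomReasoning using (begin_; step-≈-⟩; _∎)
  open Soundness 𝒞 c

  Ξ : Ctx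
  Ξ = (o ⊗ o) ∷ []

  ξ : Tm Ξ (o ⊗ o)
  ξ = var here

  -- The variable ξ is read as ⟨ f , g ⟩.
  R : (A : Ty) → Tm Ξ A → Hom c' (⟦ A ⟧ᵀ c) → Set (ℓh ⊔ ℓe)
  R o       s h = Lift ℓh ((s ≈βη fst ξ × h ≈ f) ⊎ (s ≈βη snd ξ × h ≈ g))
  R (A ⇒ C) s h = ∀ s' h' → R A s' h' → R C (app s s') (eval ∘ ⟨ h , h' ⟩)
  R (A ⊗ C) s h = R A (fst s) (π₁ ∘ h) × R C (snd s) (π₂ ∘ h)
  R 𝟙       s h = Unit

  R-resp : ∀ A {s s' h h'} → R A s h → s ≈βη s' → h ≈ h' → R A s' h'
  R-resp o (lift (inj₁ (s≈ , h≈))) s≈s' h≈h' =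
    lift (inj₁ (≈trans (≈sym s≈s') s≈ , ≈.trans (≈.sym h≈h') h≈))
  R-resp o (lift (inj₂ (s≈ , h≈))) s≈s' h≈h' =
    lift (inj₂ (≈trans (≈sym s≈s') s≈ , ≈.trans (≈.sym h≈h') h≈))
  R-resp (A ⇒ C) r s≈s' h≈h' s'' h'' r' =
    R-resp C (r s'' h'' r') (app-cong s≈s' ≈refl) (∘-resp-≈ʳ (⟨⟩-cong h≈h' ≈.refl))
  R-resp (A ⊗ C) (r₁ , r₂) s≈s' h≈h' =
    R-resp A r₁ (fst-cong s≈s') (∘-resp-≈ʳ h≈h') , R-resp C r₂ (snd-cong s≈s') (∘-resp-≈ʳ h≈h')
  R-resp 𝟙 r s≈s' h≈h' = r

  Rˢ : ∀ Γ → Sub Γ Ξ → Hom c' (⟦ Γ ⟧ᶜ c) → Set (ℓh ⊔ ℓe)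
  Rˢ []      σ γ = Unit
  Rˢ (A ∷ Γ) σ γ = Rˢ Γ (λ x → σ (there x)) (π₁ ∘ γ) × R A (σ here) (π₂ ∘ γ)

  Rˢ-resp : ∀ Γ {σ : Sub Γ Ξ} {γ γ'} → Rˢ Γ σ γ → γ ≈ γ' → Rˢ Γ σ γ'
  Rˢ-resp []      r        γ≈γ' = r
  Rˢ-resp (A ∷ Γ) (r , r') γ≈γ' = Rˢ-resp Γ r (∘-resp-≈ʳ γ≈γ') , R-resp A r' ≈refl (∘-resp-≈ʳ γ≈γ')

  fundamental-var : ∀ {Γ A} (x : Γ ∋ A) {σ : Sub Γ Ξ} {γ} → Rˢ Γ σ γ → R A (σ x) (⟦ x ⟧ᵛ c ∘ γ)
  fundamental-var here          (r , r') = r'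
  fundamental-var {A = A} (there x) (r , r') = R-resp A (fundamental-var x r) ≈refl (≈.sym assoc)

  fundamental : ∀ {Γ A} (t : Tm Γ A) {σ : Sub Γ Ξ} {γ} → Rˢ Γ σ γ → R A (subst σ t) (⟦ t ⟧ᵗ c ∘ γ)
  fundamental (var x) r = fundamental-var x r
  fundamental {Γ} (lam {A} {C} t) {σ} {γ} r s' h' r' =
    R-resp C (fundamental t r-extended) β-step (≈.sym eval∘⟨curry∘,⟩)
    where
    r-extended : Rˢ (A ∷ Γ) (s' ∷ˢ σ) ⟨ γ , h' ⟩
    r-extended = Rˢ-resp Γ r (≈.sym project₁) , R-resp A r' ≈refl (≈.sym project₂)

    β-step : subst (s' ∷ˢ σ) t ≈βη app (lam (subst (exts σ) t)) s'
    β-step = ≈sym (≡-subst (app (lam (subst (exts σ) t)) s' ≈βη_) (subst-exts-[]₀ σ t s') (β⇒ _ s'))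
  fundamental (app {B = C} t u) r =
    R-resp C (fundamental t r _ _ (fundamental u r)) ≈refl (≈.trans (∘-resp-≈ʳ (≈.sym ⟨⟩∘)) (≈.sym assoc))
  fundamental (pair {A} {C} t u) r =
    R-resp A (fundamental t r) (≈sym (β⊗₁ _ _)) (≈.trans (∘-resp-≈ˡ (≈.sym project₁)) assoc) ,
    R-resp C (fundamental u r) (≈sym (β⊗₂ _ _)) (≈.trans (∘-resp-≈ˡ (≈.sym project₂)) assoc)
  fundamental (fst {A} t) r = R-resp A (proj₁ (fundamental t r)) ≈refl (≈.sym assoc)
  fundamental (snd {B = C} t) r = R-resp C (proj₂ (fundamental t r)) ≈refl (≈.sym assoc)
  fundamental unit r = _

  select : Hom ⊤ (⟦ Bool ⟧ᵀ c) → Hom c' c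
  select h = eval ∘ ⟨ h ∘ ! , ⟨ f , g ⟩ ⟩

  select-cong : ∀ {h h'} → h ≈ h' → select h ≈ select h'
  select-cong h≈h' = ∘-resp-≈ʳ (⟨⟩-cong (∘-resp-≈ˡ h≈h') ≈.refl)

  select-true : select (⟦ true ⟧ᵗ c) ≈ f
  select-true = begin
    eval ∘ ⟨ curry (π₁ ∘ π₂) ∘ ! , ⟨ f , g ⟩ ⟩  ≈⟨ eval∘⟨curry∘,⟩ ⟩
    (π₁ ∘ π₂) ∘ ⟨ ! , ⟨ f , g ⟩ ⟩              ≈⟨ assoc ⟩
    π₁ ∘ (π₂ ∘ ⟨ ! , ⟨ f , g ⟩ ⟩)              ≈⟨ ∘-resp-≈ʳ project₂ ⟩
    π₁ ∘ ⟨ f , g ⟩                             ≈⟨ project₁ ⟩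
    f                                          ∎

  R-closed-Bool : (u : CTm Bool) → R o (app (weaken u) ξ) (select (⟦ u ⟧ᵗ c))
  R-closed-Bool u = ≡-subst (λ s → R o (app s ξ) (select (⟦ u ⟧ᵗ c))) (≡-sym weaken≡subst)
                            (fundamental u {σ = λ ()} _ ξ ⟨ f , g ⟩ R-ξ)
    where
    R-ξ : R (o ⊗ o) ξ ⟨ f , g ⟩
    R-ξ = lift (inj₁ (≈refl , project₁)) , lift (inj₂ (≈refl , project₂))

    weaken≡subst : weaken u ≡ subst (λ ()) u
    weaken≡subst = ≡-trans (rename≡subst-var there u) (subst-cong (λ ()) u)

  ≈βη-true⇔select≈f : ¬ f ≈ g → (u : CTm Bool) → u ≈βη true ⇔ select (⟦ u ⟧ᵗ c) ≈ f
  ≈βη-true⇔select≈f f≉g u = mk⇔ (λ u≈true → ≈.trans (select-cong (sound u≈true)) select-true) from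
    where
    from : select (⟦ u ⟧ᵗ c) ≈ f → u ≈βη true
    from sel≈f with R-closed-Bool u
    ... | lift (inj₁ (ux≈fst , _)) = ≈trans (η⇒ u) (lam-cong ux≈fst)
    ... | lift (inj₂ (_ , sel≈g)) = ⊥-elim (f≉g (≈.trans (≈.sym sel≈f) sel≈g))

theorem3p2 : ∀ {ℓo ℓh ℓe} (𝒞 : CCC ℓo ℓh ℓe) → NonDegenerate 𝒞 →
    (A : Ty) (L : CTm A → Set) →
    Σ Ty (λ B → Σ (CTm ((A [ B ]ᵀ) ⇒ Bool)) λ r →
      ∀ (t : CTm A) → L t ⇔ (app r (t [ B ]ᵗ) ≈βη true)) →
    Σ (CCC.Obj 𝒞) λ e →
      Σ (CCC.Hom 𝒞 (CCC.⊤ 𝒞) (Interp.⟦_⟧ᵀ 𝒞 A e) → Set ℓe) λ F →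
        (∀ {f g} → CCC._≈_ 𝒞 f g → F f → F g)
        × (∀ (t : CTm A) → L t ⇔ F (Interp.⟦_⟧ᵗ 𝒞 t e))
theorem3p2 {ℓe = ℓe} 𝒞 (c' , c , f , g , f≉g) A L (B , r , L⇔r≈true) =
  ⟦ B ⟧ᵀ c , F , F-resp , λ t → ≡-subst (L t ⇔_) (F-⟦⟧ t) (≈βη-true⇔select≈f f≉g _ ⇔-∘ L⇔r≈true t)
  where
  open CCC 𝒞
  open Interp 𝒞
  open CCCProperties 𝒞 using (∘-resp-≈ʳ; ⟨⟩-cong; module ≈)
  open TypeSubstitution 𝒞 c B
  open BoolObservation 𝒞 f g

  run-r : Hom ⊤ (⟦ A ⟧ᵀ (⟦ B ⟧ᵀ c)) → Hom ⊤ (⟦ Bool ⟧ᵀ c)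
  run-r h = eval ∘ ⟨ ⟦ r ⟧ᵗ c , cast refl (⟦⟧ᵀ-[]ᵀ A) h ⟩

  F : Hom ⊤ (⟦ A ⟧ᵀ (⟦ B ⟧ᵀ c)) → Set ℓe
  F h = select (run-r h) ≈ f

  F-resp : ∀ {h h'} → h ≈ h' → F h → F h'
  F-resp h≈h' = ≈.trans (select-cong (∘-resp-≈ʳ (⟨⟩-cong ≈.refl (cast-≈ refl (⟦⟧ᵀ-[]ᵀ A) (≈.sym h≈h')))))

  F-⟦⟧ : (t : CTm A) → (select (⟦ app r (t [ B ]ᵗ) ⟧ᵗ c) ≈ f) ≡ F (⟦ t ⟧ᵗ (⟦ B ⟧ᵀ c))
  F-⟦⟧ t = cong (λ h → select (eval ∘ ⟨ ⟦ r ⟧ᵗ c , h ⟩) ≈ f) (≡-sym (⟦⟧ᵗ-[]ᵗ t))
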